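{- Let $i,m\geq0$ and $l$ be integers with $0\leq l\leq m+1$. Then \begin{align*} M_{i,m,l}&=\binom{m}{l}\frac{(-1)^l m!}{(m+i+l+1/2)_{m+1}}\{y^2+l(2m+2i+l+2)-i^2\}\\ &\quad\cdot(x+m+i+l)_{2m+2i+2l+1}(y+m+i)_{m-l}(y-i-l-1)_{m-l}. \end{align*}
   Context: Falling factorials: for an integer $k\geq0$, $(\alpha)_k=\alpha(\alpha-1)\cdots(\alpha-k+1)$, $(\alpha)_0=1$; for a negative integer $k=-n$, $(\alpha)_{ -n}=1/((\alpha+1)(\alpha+2)\cdots(\alpha+n))$ (i.e. $(\alpha)_k=\Gamma(\alpha+1)/\Gamma(\alpha-k+1)$). Binomial coefficients $\binom{m}{u}$ are $0$ for $u>m$. All expressions are rational functions in the variables $x,y$ over $\mathbb{Q}$. For integers $i\geq -1$, $m,u\geq0$ define $$F_{i,m,u}=\binom{m}{u}\frac{(-1)^u m!}{(m+i+u+1/2)_{m+1}}(x+m+i+u)_{2m+2i+2u+1}(y+m+i)_{m-u}(y-i-u-1)_{m-u},$$ for integers $l\geq0$ put $S_{i,m,l}=\sum_{l\leq u\leq m}F_{i,m,u}$ (an empty sum is $0$), and $$M_{i,m,l}=-2S_{i+1,m,l}+\bigl(x^2+y^2-(i+m+1)^2-i^2\bigr)S_{i,m,l}-\frac{2i-1}{2m+2}S_{i-1,m+1,l+1}.$$ -}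

module Defs where

open import Data.Nat as ℕ using (ℕ; zero; suc; _∸_; _!)
open import Data.Nat.Combinatorics using (_C_)
open import Data.Integer as ℤ using (ℤ; +_; -[1+_])
open import Data.Rational using (ℚ; mkℚ; _+_; _*_; _-_; -_; 1/_; _/_; 0ℚ; 1ℚ; ½)

ℕ→ℚ : ℕ → ℚ
ℕ→ℚ n = (+ n) / 1

ℤ→ℚ : ℤ → ℚ
ℤ→ℚ k = k / 1

-- total inverse on ℚ (convention: inv 0 = 0; only ever hit at poles)
inv : ℚ → ℚ
inv (mkℚ (+ zero) _ _) = 0ℚ
inv p@(mkℚ (+ suc _) _ _) = 1/ p
inv p@(mkℚ -[1+ _ ] _ _) = 1/ p

ff : ℚ → ℕ → ℚ
ff a zero    = 1ℚ
ff a (suc k) = a * ff (a - 1ℚ) k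

rise : ℚ → ℕ → ℚ
rise a zero    = 1ℚ
rise a (suc k) = a * rise (a + 1ℚ) k

ffℤ : ℚ → ℤ → ℚ
ffℤ a (+ k)      = ff a k
ffℤ a -[1+ n ]   = inv (rise (a + 1ℚ) (suc n))

sgn : ℕ → ℚ
sgn zero    = 1ℚ
sgn (suc u) = - sgn u

sumBelow : ℕ → (ℕ → ℚ) → ℚ
sumBelow zero    f = 0ℚ
sumBelow (suc n) f = sumBelow n f + f n

-- Σ_{l ≤ u ≤ m} f u   (empty sum = 0 when l > m)
sumRange : ℕ → ℕ → (ℕ → ℚ) → ℚ
sumRange l m f = sumBelow (suc m ∸ l) (λ k → f (l ℕ.+ k))

F : (x y : ℚ) → ℤ → ℕ → ℕ → ℚ
F x y i m u =
  ℕ→ℚ (m C u) * sgn u * ℕ→ℚ (m !)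
  * inv (ff (ℤ→ℚ (+ m ℤ.+ i ℤ.+ + u) + ½) (suc m))
  * ffℤ (x + ℤ→ℚ (+ m ℤ.+ i ℤ.+ + u)) (+ 2 ℤ.* + m ℤ.+ + 2 ℤ.* i ℤ.+ + 2 ℤ.* + u ℤ.+ + 1)
  * ffℤ (y + ℤ→ℚ (+ m ℤ.+ i)) (+ m ℤ.- + u)
  * ffℤ (y - ℤ→ℚ i - ℕ→ℚ u - 1ℚ) (+ m ℤ.- + u)

S : (x y : ℚ) → ℤ → ℕ → ℕ → ℚ
S x y i m l = sumRange l m (F x y i m)

M : (x y : ℚ) → ℤ → ℕ → ℕ → ℚ
M x y i m l =
  - (ℕ→ℚ 2 * S x y (i ℤ.+ + 1) m l)
  + (x * x + y * y - ℤ→ℚ (i ℤ.+ + m ℤ.+ + 1) * ℤ→ℚ (i ℤ.+ + m ℤ.+ + 1) - ℤ→ℚ i * ℤ→ℚ i)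
    * S x y i m l
  - ℤ→ℚ (+ 2 ℤ.* i ℤ.- + 1) * inv (ℕ→ℚ (2 ℕ.* m ℕ.+ 2)) * S x y (i ℤ.- + 1) (suc m) (suc l)

RHS : (x y : ℚ) → ℕ → ℕ → ℕ → ℚ
RHS x y i m l =
  ℕ→ℚ (m C l) * sgn l * ℕ→ℚ (m !)
  * inv (ff (ℕ→ℚ (m ℕ.+ i ℕ.+ l) + ½) (suc m))
  * (y * y + ℕ→ℚ (l ℕ.* (2 ℕ.* m ℕ.+ 2 ℕ.* i ℕ.+ l ℕ.+ 2)) - ℕ→ℚ i * ℕ→ℚ i)
  * ff (x + ℕ→ℚ (m ℕ.+ i ℕ.+ l)) (2 ℕ.* m ℕ.+ 2 ℕ.* i ℕ.+ 2 ℕ.* l ℕ.+ 1)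
  * ffℤ (y + ℕ→ℚ (m ℕ.+ i)) (+ m ℤ.- + l)
  * ffℤ (y - ℕ→ℚ i - ℕ→ℚ l - 1ℚ) (+ m ℤ.- + l)

-- M_{i,m,l} = Σ_{u=l}^{m} T_u with T_u = -2F_{i+1,m,u} + c F_{i,m,u} - K F_{i-1,m+1,u+1}
-- (the last sum reindexed by u ↦ u+1).  Writing R_u for the right-hand side, the sum
-- telescopes once T_u + R_{u+1} = R_u for u ≤ m, because R_{m+1} = 0 as C(m,m+1) = 0.
-- For that identity put N = m+i+u and ω = C(m,u)(-1)^u m!/((u+1)(N+3/2)_{m+2}).
-- Neighbouring binomial coefficients, factorials and Pochhammer symbols differ by
-- rational factors, so each of the five terms is ω times a polynomial, times
-- (x+N)_{2N+1} and a product of two falling factorials in y; after peeling off at most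
-- two linear factors these y-factors coincide.  What is left is a polynomial identity
-- in x, y, i, u, m, checked by the ring solver; for u = m the y-factors are empty and
-- the identity is a different one.

{-# OPTIONS --safe #-}
module Submission where

open import Defs
open import Data.Nat as ℕ using (ℕ; zero; suc; _≤_; _<_; _∸_; _!; s≤s)
import Data.Nat.Properties as ℕP
open import Data.Nat.Combinatorics
  using (_C_; k![n∸k]!∣n!; nCk+nC[k+1]≡[n+1]C[k+1])
open import Data.Nat.Combinatorics.Specification using (nCk≡n!/k![n-k]!; k>n⇒nCk≡0)
open import Data.Nat.DivMod using (m/n*n≡m)
import Data.Nat.Tactic.RingSolver as ℕ-Solver
open import Data.Integer as ℤ using (ℤ; +_; -[1+_]; +[1+_])
import Data.Integer.Properties as ℤP
import Data.Integer.Tactic.RingSolver as ℤ-Solver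
open import Data.Rational using (ℚ; mkℚ; _+_; _*_; _-_; -_; 0ℚ; 1ℚ; ½; toℚᵘ; Positive)
import Data.Rational.Properties as ℚP
open import Data.Rational.Unnormalised as ℚᵘ using (mkℚᵘ; *≡*)
import Data.Rational.Unnormalised.Properties as ℚᵘP
open import Relation.Binary.PropositionalEquality
  using (_≡_; refl; sym; trans; cong; cong₂; subst; module ≡-Reasoning)
open import Relation.Nullary.Decidable using (dec⇒maybe)
open import Level using (0ℓ)
open import Data.List.Base using (_∷_; [])
open import Tactic.RingSolver using (solve-∀; solve)
open import Tactic.RingSolver.Core.AlmostCommutativeRing
  using (AlmostCommutativeRing; fromCommutativeRing)

ℚ-ring : AlmostCommutativeRing 0ℓ 0ℓ
ℚ-ring = fromCommutativeRing ℚP.+-*-commutativeRing (λ p → dec⇒maybe (0ℚ ℚP.≟ p))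

toℚᵘ-ℤ→ℚ : ∀ z → toℚᵘ (ℤ→ℚ z) ℚᵘ.≃ mkℚᵘ z 0
toℚᵘ-ℤ→ℚ z = ℚP.toℚᵘ-fromℚᵘ (mkℚᵘ z 0)

ℤ→ℚ-+ : ∀ a b → ℤ→ℚ (a ℤ.+ b) ≡ ℤ→ℚ a + ℤ→ℚ b
ℤ→ℚ-+ a b = ℚP.toℚᵘ-injective (begin
  toℚᵘ (ℤ→ℚ (a ℤ.+ b))              ≈⟨ toℚᵘ-ℤ→ℚ (a ℤ.+ b) ⟩
  mkℚᵘ (a ℤ.+ b) 0                   ≈⟨ *≡* (sum-over-1 a b) ⟩
  mkℚᵘ a 0 ℚᵘ.+ mkℚᵘ b 0             ≈⟨ ℚᵘP.+-cong (toℚᵘ-ℤ→ℚ a) (toℚᵘ-ℤ→ℚ b) ⟨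
  toℚᵘ (ℤ→ℚ a) ℚᵘ.+ toℚᵘ (ℤ→ℚ b)    ≈⟨ ℚP.toℚᵘ-homo-+ (ℤ→ℚ a) (ℤ→ℚ b) ⟨
  toℚᵘ (ℤ→ℚ a + ℤ→ℚ b)              ∎)
  where
  open ℚᵘP.≃-Reasoning
  sum-over-1 : ∀ a b → (a ℤ.+ b) ℤ.* + 1 ≡ (a ℤ.* + 1 ℤ.+ b ℤ.* + 1) ℤ.* + 1
  sum-over-1 = ℤ-Solver.solve-∀

ℤ→ℚ-* : ∀ a b → ℤ→ℚ (a ℤ.* b) ≡ ℤ→ℚ a * ℤ→ℚ b
ℤ→ℚ-* a b = ℚP.toℚᵘ-injective (begin
  toℚᵘ (ℤ→ℚ (a ℤ.* b))              ≈⟨ toℚᵘ-ℤ→ℚ (a ℤ.* b) ⟩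
  mkℚᵘ (a ℤ.* b) 0                   ≈⟨ *≡* refl ⟩
  mkℚᵘ a 0 ℚᵘ.* mkℚᵘ b 0             ≈⟨ ℚᵘP.*-cong (toℚᵘ-ℤ→ℚ a) (toℚᵘ-ℤ→ℚ b) ⟨
  toℚᵘ (ℤ→ℚ a) ℚᵘ.* toℚᵘ (ℤ→ℚ b)    ≈⟨ ℚP.toℚᵘ-homo-* (ℤ→ℚ a) (ℤ→ℚ b) ⟨
  toℚᵘ (ℤ→ℚ a * ℤ→ℚ b)              ∎)
  where open ℚᵘP.≃-Reasoning

ℕ→ℚ-+ : ∀ a b → ℕ→ℚ (a ℕ.+ b) ≡ ℕ→ℚ a + ℕ→ℚ b
ℕ→ℚ-+ a b = ℤ→ℚ-+ (+ a) (+ b)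

ℕ→ℚ-* : ∀ a b → ℕ→ℚ (a ℕ.* b) ≡ ℕ→ℚ a * ℕ→ℚ b
ℕ→ℚ-* a b = trans (cong ℤ→ℚ (ℤP.pos-* a b)) (ℤ→ℚ-* (+ a) (+ b))

ℕ→ℚ-suc : ∀ a → ℕ→ℚ (suc a) ≡ ℕ→ℚ a + 1ℚ
ℕ→ℚ-suc a = trans (ℕ→ℚ-+ 1 a) (ℚP.+-comm 1ℚ (ℕ→ℚ a))

ℕ→ℚ-*-suc : ∀ a n → ℕ→ℚ (a ℕ.* suc n) ≡ ℕ→ℚ a * (ℕ→ℚ n + 1ℚ)
ℕ→ℚ-*-suc a n = trans (ℕ→ℚ-* a (suc n)) (cong (ℕ→ℚ a *_) (ℕ→ℚ-suc n))

ℕ→ℚ-∸ : ∀ {m n} → n ≤ m → ℕ→ℚ (m ∸ n) ≡ ℕ→ℚ m - ℕ→ℚ n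
ℕ→ℚ-∸ {m} {n} n≤m = begin
  ℕ→ℚ (m ∸ n)                    ≡⟨ cancel (ℕ→ℚ (m ∸ n)) (ℕ→ℚ n) ⟨
  ℕ→ℚ n + ℕ→ℚ (m ∸ n) - ℕ→ℚ n    ≡⟨ cong (_- ℕ→ℚ n) (ℕ→ℚ-+ n (m ∸ n)) ⟨
  ℕ→ℚ (n ℕ.+ (m ∸ n)) - ℕ→ℚ n    ≡⟨ cong (λ t → ℕ→ℚ t - ℕ→ℚ n) (ℕP.m+[n∸m]≡n n≤m) ⟩
  ℕ→ℚ m - ℕ→ℚ n                  ∎
  where
  open ≡-Reasoning
  cancel : ∀ a b → b + a - b ≡ a
  cancel = solve-∀ ℚ-ring

inv-*-cancel : ∀ p .{{_ : Positive p}} → inv p * p ≡ 1ℚ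
inv-*-cancel p@(mkℚ +[1+ _ ] _ _) = ℚP.*-inverseˡ p

*-transpose : ∀ {a} b c d .{{_ : Positive d}} → a * d ≡ b * c → a ≡ b * inv d * c
*-transpose {a} b c d eq = begin
  a                    ≡⟨ ℚP.*-identityʳ a ⟨
  a * 1ℚ               ≡⟨ cong (a *_) (inv-*-cancel d) ⟨
  a * (inv d * d)      ≡⟨ swap a (inv d) d ⟩
  a * d * inv d        ≡⟨ cong (_* inv d) eq ⟩
  b * c * inv d        ≡⟨ swap′ b c (inv d) ⟩
  b * inv d * c        ∎
  where
  open ≡-Reasoning
  swap : ∀ a e d → a * (e * d) ≡ a * d * e
  swap = solve-∀ ℚ-ring
  swap′ : ∀ b c e → b * c * e ≡ b * e * c
  swap′ = solve-∀ ℚ-ring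

inv-swap : ∀ p q a b .{{_ : Positive p}} .{{_ : Positive q}} →
           p * a ≡ b * q → inv p * b ≡ inv q * a
inv-swap p q a b eq = begin
  inv p * b                      ≡⟨ ℚP.*-identityʳ (inv p * b) ⟨
  inv p * b * 1ℚ                 ≡⟨ cong (inv p * b *_) (inv-*-cancel q) ⟨
  inv p * b * (inv q * q)        ≡⟨ shuffle (inv p) b (inv q) q ⟩
  inv p * (b * q) * inv q        ≡⟨ cong (λ t → inv p * t * inv q) eq ⟨
  inv p * (p * a) * inv q        ≡⟨ shuffle′ (inv p) p a (inv q) ⟩
  inv p * p * (inv q * a)        ≡⟨ cong (_* (inv q * a)) (inv-*-cancel p) ⟩
  1ℚ * (inv q * a)               ≡⟨ ℚP.*-identityˡ (inv q * a) ⟩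
  inv q * a                      ∎
  where
  open ≡-Reasoning
  shuffle : ∀ e b f q → e * b * (f * q) ≡ e * (b * q) * f
  shuffle = solve-∀ ℚ-ring
  shuffle′ : ∀ e p a f → e * (p * a) * f ≡ e * p * (f * a)
  shuffle′ = solve-∀ ℚ-ring

inv[2n+2]*[n+1]²≡[n+1]*½ : ∀ n → inv (ℕ→ℚ (2 ℕ.* n ℕ.+ 2)) * ((ℕ→ℚ n + 1ℚ) * (ℕ→ℚ n + 1ℚ)) ≡ (ℕ→ℚ n + 1ℚ) * ½
inv[2n+2]*[n+1]²≡[n+1]*½ n =
  trans (inv-swap (ℕ→ℚ (2 ℕ.* n ℕ.+ 2)) 1ℚ ((ℕ→ℚ n + 1ℚ) * ½) ((ℕ→ℚ n + 1ℚ) * (ℕ→ℚ n + 1ℚ))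
                  {{2n+2-positive}} (trans (cong (_* ((ℕ→ℚ n + 1ℚ) * ½)) 2n+2≡) (halve (ℕ→ℚ n))))
        (ℚP.*-identityˡ _)
  where
  2n+2-positive : Positive (ℕ→ℚ (2 ℕ.* n ℕ.+ 2))
  2n+2-positive = subst (λ k → Positive (ℕ→ℚ k)) (ℕP.+-comm 2 (2 ℕ.* n))
                        (ℚP.normalize-pos (2 ℕ.+ 2 ℕ.* n) 1)
  2n+2≡ : ℕ→ℚ (2 ℕ.* n ℕ.+ 2) ≡ ℕ→ℚ 2 * ℕ→ℚ n + ℕ→ℚ 2
  2n+2≡ = trans (ℕ→ℚ-+ (2 ℕ.* n) 2) (cong (_+ ℕ→ℚ 2) (ℕ→ℚ-* 2 n))
  halve : ∀ a → (ℕ→ℚ 2 * a + ℕ→ℚ 2) * ((a + 1ℚ) * ½) ≡ (a + 1ℚ) * (a + 1ℚ) * 1ℚ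
  halve = solve-∀ ℚ-ring

lincomb : ℚ → ℚ → ℚ → ℚ → ℚ → ℚ → ℚ
lincomb α β γ a b d = - (α * a) + β * b - γ * d

sumBelow-lincomb : ∀ α β γ n f g h →
  sumBelow n (λ k → lincomb α β γ (f k) (g k) (h k)) ≡
  lincomb α β γ (sumBelow n f) (sumBelow n g) (sumBelow n h)
sumBelow-lincomb α β γ zero    f g h = sym (empty α β γ)
  where
  empty : ∀ α β γ → - (α * 0ℚ) + β * 0ℚ - γ * 0ℚ ≡ 0ℚ
  empty = solve-∀ ℚ-ring
sumBelow-lincomb α β γ (suc n) f g h =
  trans (cong (_+ lincomb α β γ (f n) (g n) (h n)) (sumBelow-lincomb α β γ n f g h))
        (additive α β γ (sumBelow n f) (sumBelow n g) (sumBelow n h) (f n) (g n) (h n))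
  where
  additive : ∀ α β γ a b d a′ b′ d′ →
    - (α * a) + β * b - γ * d + (- (α * a′) + β * b′ - γ * d′) ≡
    - (α * (a + a′)) + β * (b + b′) - γ * (d + d′)
  additive = solve-∀ ℚ-ring

sumBelow-telescope : ∀ n (f g : ℕ → ℚ) → (∀ k → k < n → f k + g (suc k) ≡ g k) →
                     sumBelow n f + g n ≡ g 0
sumBelow-telescope zero    f g step = ℚP.+-identityˡ (g 0)
sumBelow-telescope (suc n) f g step = begin
  sumBelow n f + f n + g (suc n)     ≡⟨ ℚP.+-assoc (sumBelow n f) (f n) (g (suc n)) ⟩
  sumBelow n f + (f n + g (suc n))   ≡⟨ cong (λ t → sumBelow n f + t) (step n (ℕP.n<1+n n)) ⟩
  sumBelow n f + g n                 ≡⟨ sumBelow-telescope n f g (λ k k<n → step k (ℕP.m<n⇒m<1+n k<n)) ⟩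
  g 0                                ∎
  where open ≡-Reasoning

sumRange-telescope : ∀ l m (f g : ℕ → ℚ) → l ≤ suc m →
  (∀ u → l ≤ u → u ≤ m → f u + g (suc u) ≡ g u) → sumRange l m f + g (suc m) ≡ g l
sumRange-telescope l m f g l≤1+m step = begin
  sumBelow n (λ k → f (l ℕ.+ k)) + g (suc m)      ≡⟨ cong (λ t → sumBelow n (λ k → f (l ℕ.+ k)) + g t) l+n≡1+m ⟨
  sumBelow n (λ k → f (l ℕ.+ k)) + g (l ℕ.+ n)    ≡⟨ sumBelow-telescope n _ _ shifted-step ⟩
  g (l ℕ.+ 0)                                     ≡⟨ cong g (ℕP.+-identityʳ l) ⟩
  g l                                             ∎
  where
  open ≡-Reasoning
  n : ℕ
  n = suc m ∸ l
  l+n≡1+m : l ℕ.+ n ≡ suc m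
  l+n≡1+m = ℕP.m+[n∸m]≡n l≤1+m
  shifted-step : ∀ k → k < n → f (l ℕ.+ k) + g (l ℕ.+ suc k) ≡ g (l ℕ.+ k)
  shifted-step k k<n = trans (cong (λ t → f (l ℕ.+ k) + g t) (ℕP.+-suc l k))
    (step (l ℕ.+ k) (ℕP.m≤m+n l k) (ℕP.≤-pred (subst (l ℕ.+ k <_) l+n≡1+m (ℕP.+-monoʳ-< l k<n))))

ff-suc-last : ∀ a k → ff a (suc k) ≡ ff a k * (a - ℕ→ℚ k)
ff-suc-last a zero    = unit a
  where
  unit : ∀ a → a * 1ℚ ≡ 1ℚ * (a - 0ℚ)
  unit = solve-∀ ℚ-ring
ff-suc-last a (suc k) = begin
  a * ff (a - 1ℚ) (suc k)                    ≡⟨ cong (a *_) (ff-suc-last (a - 1ℚ) k) ⟩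
  a * (ff (a - 1ℚ) k * (a - 1ℚ - ℕ→ℚ k))     ≡⟨ shuffle a (ff (a - 1ℚ) k) (ℕ→ℚ k) ⟩
  a * ff (a - 1ℚ) k * (a - (ℕ→ℚ k + 1ℚ))     ≡⟨ cong (λ t → a * ff (a - 1ℚ) k * (a - t)) (ℕ→ℚ-suc k) ⟨
  a * ff (a - 1ℚ) k * (a - ℕ→ℚ (suc k))      ∎
  where
  open ≡-Reasoning
  shuffle : ∀ a f k → a * (f * (a - 1ℚ - k)) ≡ a * f * (a - (k + 1ℚ))
  shuffle = solve-∀ ℚ-ring

ff-shift : ∀ a k → ff (a + 1ℚ) (suc k) * (a - ℕ→ℚ k) ≡ (a + 1ℚ) * ff a (suc k)
ff-shift a k = begin
  (a + 1ℚ) * ff (a + 1ℚ - 1ℚ) k * (a - ℕ→ℚ k)   ≡⟨ cong (λ b → (a + 1ℚ) * ff b k * (a - ℕ→ℚ k)) (+1-1 a) ⟩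
  (a + 1ℚ) * ff a k * (a - ℕ→ℚ k)               ≡⟨ ℚP.*-assoc (a + 1ℚ) (ff a k) (a - ℕ→ℚ k) ⟩
  (a + 1ℚ) * (ff a k * (a - ℕ→ℚ k))             ≡⟨ cong ((a + 1ℚ) *_) (ff-suc-last a k) ⟨
  (a + 1ℚ) * ff a (suc k)                       ∎
  where
  open ≡-Reasoning
  +1-1 : ∀ a → a + 1ℚ - 1ℚ ≡ a
  +1-1 = solve-∀ ℚ-ring

ff-pair-cong : ∀ {s s′ t t′} n → s ≡ s′ → t ≡ t′ → ff s n * ff t n ≡ ff s′ n * ff t′ n
ff-pair-cong n = cong₂ (λ s t → ff s n * ff t n)

ff-pair-peel : ∀ a b e →
  ff a (suc e) * ff b (suc e) ≡ (a - ℕ→ℚ e) * b * (ff a e * ff (b - 1ℚ) e)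
ff-pair-peel a b e = begin
  ff a (suc e) * (b * ff (b - 1ℚ) e)          ≡⟨ cong (_* (b * ff (b - 1ℚ) e)) (ff-suc-last a e) ⟩
  ff a e * (a - ℕ→ℚ e) * (b * ff (b - 1ℚ) e)  ≡⟨ shuffle (ff a e) (a - ℕ→ℚ e) b (ff (b - 1ℚ) e) ⟩
  (a - ℕ→ℚ e) * b * (ff a e * ff (b - 1ℚ) e)  ∎
  where
  open ≡-Reasoning
  shuffle : ∀ f s b g → f * s * (b * g) ≡ s * b * (f * g)
  shuffle = solve-∀ ℚ-ring

ff-pair-shift-peel : ∀ a b e →
  ff (a + 1ℚ) (suc e) * ff (b - 1ℚ) (suc e) ≡ (a + 1ℚ) * (b - 1ℚ - ℕ→ℚ e) * (ff a e * ff (b - 1ℚ) e)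
ff-pair-shift-peel a b e = begin
  (a + 1ℚ) * ff (a + 1ℚ - 1ℚ) e * ff (b - 1ℚ) (suc e)
    ≡⟨ cong₂ (λ s t → (a + 1ℚ) * ff s e * t) (cancel a) (ff-suc-last (b - 1ℚ) e) ⟩
  (a + 1ℚ) * ff a e * (ff (b - 1ℚ) e * (b - 1ℚ - ℕ→ℚ e))
    ≡⟨ shuffle (a + 1ℚ) (ff a e) (ff (b - 1ℚ) e) (b - 1ℚ - ℕ→ℚ e) ⟩
  (a + 1ℚ) * (b - 1ℚ - ℕ→ℚ e) * (ff a e * ff (b - 1ℚ) e)
    ∎
  where
  open ≡-Reasoning
  cancel : ∀ a → a + 1ℚ - 1ℚ ≡ a
  cancel = solve-∀ ℚ-ring
  shuffle : ∀ s f g t → s * f * (g * t) ≡ s * t * (f * g)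
  shuffle = solve-∀ ℚ-ring

half-positive : ∀ n → Positive (ℕ→ℚ n + ½)
half-positive n = ℚP.nonNeg+pos⇒pos (ℕ→ℚ n) {{ℚP.normalize-nonNeg n 1}} ½

half-suc : ∀ n → ℕ→ℚ (suc n) + ½ ≡ ℕ→ℚ n + ½ + 1ℚ
half-suc n = trans (cong (_+ ½) (ℕ→ℚ-suc n)) (shuffle (ℕ→ℚ n))
  where
  shuffle : ∀ a → a + 1ℚ + ½ ≡ a + ½ + 1ℚ
  shuffle = solve-∀ ℚ-ring

half-suc-pred : ∀ n → ℕ→ℚ (suc n) + ½ - 1ℚ ≡ ℕ→ℚ n + ½
half-suc-pred n = trans (cong (_- 1ℚ) (half-suc n)) (shuffle (ℕ→ℚ n))
  where
  shuffle : ∀ a → a + ½ + 1ℚ - 1ℚ ≡ a + ½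
  shuffle = solve-∀ ℚ-ring

ff-half-positive : ∀ {k n} → k ≤ n → Positive (ff (ℕ→ℚ n + ½) (suc k))
ff-half-positive {zero} {n} _ = ℚP.pos*pos⇒pos (ℕ→ℚ n + ½) {{half-positive n}} 1ℚ
ff-half-positive {suc k} {suc n} (s≤s k≤n) =
  ℚP.pos*pos⇒pos (ℕ→ℚ (suc n) + ½) {{half-positive (suc n)}} (ff (ℕ→ℚ (suc n) + ½ - 1ℚ) (suc k))
    {{subst (λ b → Positive (ff b (suc k))) (sym (half-suc-pred n)) (ff-half-positive k≤n)}}

central : ℚ → ℕ → ℚ
central x j = ff (x + ℕ→ℚ j) (suc (2 ℕ.* j))

central-suc : ∀ x j → central x (suc j) ≡ (x + ℕ→ℚ j + 1ℚ) * central x j * (x - ℕ→ℚ j - 1ℚ)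
central-suc x j = begin
  ff a (suc (2 ℕ.* suc j))
    ≡⟨ cong (λ k → ff a (suc k)) (ℕP.*-suc 2 j) ⟩
  a * ff (a - 1ℚ) (suc (suc (2 ℕ.* j)))
    ≡⟨ cong (a *_) (ff-suc-last (a - 1ℚ) (suc (2 ℕ.* j))) ⟩
  a * (ff (a - 1ℚ) (suc (2 ℕ.* j)) * (a - 1ℚ - ℕ→ℚ (suc (2 ℕ.* j))))
    ≡⟨ cong₂ (λ s t → s * (ff (s - 1ℚ) (suc (2 ℕ.* j)) * (s - 1ℚ - t))) a≡ 2j+1≡ ⟩
  (x + J + 1ℚ) * (ff (x + J + 1ℚ - 1ℚ) (suc (2 ℕ.* j)) * (x + J + 1ℚ - 1ℚ - (ℕ→ℚ 2 * J + 1ℚ)))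
    ≡⟨ cong₂ (λ s t → (x + J + 1ℚ) * (ff s (suc (2 ℕ.* j)) * t)) (cancel x J) (outer x J) ⟩
  (x + J + 1ℚ) * (central x j * (x - J - 1ℚ))
    ≡⟨ ℚP.*-assoc (x + J + 1ℚ) (central x j) (x - J - 1ℚ) ⟨
  (x + J + 1ℚ) * central x j * (x - J - 1ℚ)
    ∎
  where
  open ≡-Reasoning
  J a : ℚ
  J = ℕ→ℚ j
  a = x + ℕ→ℚ (suc j)
  a≡ : a ≡ x + J + 1ℚ
  a≡ = trans (cong (λ t → x + t) (ℕ→ℚ-suc j)) (sym (ℚP.+-assoc x J 1ℚ))
  2j+1≡ : ℕ→ℚ (suc (2 ℕ.* j)) ≡ ℕ→ℚ 2 * J + 1ℚ
  2j+1≡ = trans (ℕ→ℚ-suc (2 ℕ.* j)) (cong (_+ 1ℚ) (ℕ→ℚ-* 2 j))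
  cancel : ∀ x J → x + J + 1ℚ - 1ℚ ≡ x + J
  cancel = solve-∀ ℚ-ring
  outer : ∀ x J → x + J + 1ℚ - 1ℚ - (ℕ→ℚ 2 * J + 1ℚ) ≡ x - J - 1ℚ
  outer = solve-∀ ℚ-ring

nCk*k!*[n∸k]!≡n! : ∀ {n k} → k ≤ n → (n C k) ℕ.* (k ! ℕ.* (n ∸ k) !) ≡ n !
nCk*k!*[n∸k]!≡n! {n} {k} k≤n rewrite nCk≡n!/k![n-k]! k≤n =
  m/n*n≡m {{ℕP._!*_!≢0 k (n ∸ k)}} (k![n∸k]!∣n! k≤n)

[1+n]C[1+k]*[1+k]≡nCk*[1+n] : ∀ {n k} → k ≤ n → (suc n C suc k) ℕ.* suc k ≡ (n C k) ℕ.* suc n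
[1+n]C[1+k]*[1+k]≡nCk*[1+n] {n} {k} k≤n =
  ℕP.*-cancelʳ-≡ _ _ (k ! ℕ.* (n ∸ k) !) {{ℕP._!*_!≢0 k (n ∸ k)}} (begin
    (suc n C suc k) ℕ.* suc k ℕ.* (k ! ℕ.* (n ∸ k) !)   ≡⟨ shuffle (suc n C suc k) k (k !) ((n ∸ k) !) ⟩
    (suc n C suc k) ℕ.* (suc k ! ℕ.* (n ∸ k) !)         ≡⟨ nCk*k!*[n∸k]!≡n! (s≤s k≤n) ⟩
    suc n ℕ.* n !                                       ≡⟨ cong (suc n ℕ.*_) (nCk*k!*[n∸k]!≡n! k≤n) ⟨
    suc n ℕ.* ((n C k) ℕ.* (k ! ℕ.* (n ∸ k) !))         ≡⟨ shuffle′ (n C k) n (k !) ((n ∸ k) !) ⟩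
    (n C k) ℕ.* suc n ℕ.* (k ! ℕ.* (n ∸ k) !)           ∎)
  where
  open ≡-Reasoning
  shuffle : ∀ c k f g → c ℕ.* suc k ℕ.* (f ℕ.* g) ≡ c ℕ.* (suc k ℕ.* f ℕ.* g)
  shuffle = ℕ-Solver.solve-∀
  shuffle′ : ∀ c n f g → suc n ℕ.* (c ℕ.* (f ℕ.* g)) ≡ c ℕ.* suc n ℕ.* (f ℕ.* g)
  shuffle′ = ℕ-Solver.solve-∀

nC[1+k]*[1+k]≡nCk*[n∸k] : ∀ {n k} → k ≤ n → (n C suc k) ℕ.* suc k ≡ (n C k) ℕ.* (n ∸ k)
nC[1+k]*[1+k]≡nCk*[n∸k] {n} {k} k≤n = ℕP.+-cancelˡ-≡ ((n C k) ℕ.* suc k) _ _ (begin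
  (n C k) ℕ.* suc k ℕ.+ (n C suc k) ℕ.* suc k   ≡⟨ ℕP.*-distribʳ-+ (suc k) (n C k) (n C suc k) ⟨
  ((n C k) ℕ.+ (n C suc k)) ℕ.* suc k           ≡⟨ cong (ℕ._* suc k) (nCk+nC[k+1]≡[n+1]C[k+1] n k) ⟩
  (suc n C suc k) ℕ.* suc k                     ≡⟨ [1+n]C[1+k]*[1+k]≡nCk*[1+n] k≤n ⟩
  (n C k) ℕ.* suc n                             ≡⟨ cong (λ t → (n C k) ℕ.* suc t) (ℕP.m+[n∸m]≡n k≤n) ⟨
  (n C k) ℕ.* (suc k ℕ.+ (n ∸ k))               ≡⟨ ℕP.*-distribˡ-+ (n C k) (suc k) (n ∸ k) ⟩
  (n C k) ℕ.* suc k ℕ.+ (n C k) ℕ.* (n ∸ k)     ∎)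
  where open ≡-Reasoning

D : ℕ → ℕ → ℚ
D j m = ff (ℕ→ℚ j + ½) (suc m)

D-positive : ∀ {j m} → m ≤ j → Positive (D j m)
D-positive = ff-half-positive

D-suc : ∀ j m → D (suc j) m * (ℕ→ℚ j + ½ - ℕ→ℚ m) ≡ (ℕ→ℚ j + ½ + 1ℚ) * D j m
D-suc j m = trans (cong (λ b → ff b (suc m) * (ℕ→ℚ j + ½ - ℕ→ℚ m)) (half-suc j))
                  (ff-shift (ℕ→ℚ j + ½) m)

D-suc-suc : ∀ j m → D (suc j) (suc m) * 1ℚ ≡ (ℕ→ℚ j + ½ + 1ℚ) * D j m
D-suc-suc j m = trans (ℚP.*-identityʳ _)
  (cong₂ (λ a b → a * ff b (suc m)) (half-suc j) (half-suc-pred j))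

κ : ℕ → ℕ → ℕ → ℚ
κ j m u = ℕ→ℚ (m C u) * sgn u * ℕ→ℚ (m !) * inv (D j m)

δ : ℕ → ℕ → ℚ
δ j u = (ℕ→ℚ u + 1ℚ) * (ℕ→ℚ j + ½ + 1ℚ)

ω : ℕ → ℕ → ℕ → ℚ
ω j m u = κ j m u * inv (δ j u)

δ-positive : ∀ j u → Positive (δ j u)
δ-positive j u = ℚP.pos*pos⇒pos (ℕ→ℚ u + 1ℚ) {{u+1}} (ℕ→ℚ j + ½ + 1ℚ) {{j+3/2}}
  where
  u+1 : Positive (ℕ→ℚ u + 1ℚ)
  u+1 = ℚP.nonNeg+pos⇒pos (ℕ→ℚ u) {{ℚP.normalize-nonNeg u 1}} 1ℚ
  j+3/2 : Positive (ℕ→ℚ j + ½ + 1ℚ)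
  j+3/2 = ℚP.pos+pos⇒pos (ℕ→ℚ j + ½) {{half-positive j}} 1ℚ

κ≡ω*δ : ∀ j m u → κ j m u ≡ ω j m u * δ j u
κ≡ω*δ j m u = *-transpose (κ j m u) (δ j u) (δ j u) {{δ-positive j u}} refl

inv-D-suc : ∀ {j m} → m ≤ j →
            inv (D (suc j) m) * (ℕ→ℚ j + ½ + 1ℚ) ≡ inv (D j m) * (ℕ→ℚ j + ½ - ℕ→ℚ m)
inv-D-suc {j} {m} m≤j =
  inv-swap (D (suc j) m) (D j m) (ℕ→ℚ j + ½ - ℕ→ℚ m) (ℕ→ℚ j + ½ + 1ℚ)
    {{D-positive (ℕP.m≤n⇒m≤1+n m≤j)}} {{D-positive m≤j}} (D-suc j m)

inv-D-suc-suc : ∀ {j m} → m ≤ j → inv (D (suc j) (suc m)) * (ℕ→ℚ j + ½ + 1ℚ) ≡ inv (D j m) * 1ℚ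
inv-D-suc-suc {j} {m} m≤j =
  inv-swap (D (suc j) (suc m)) (D j m) 1ℚ (ℕ→ℚ j + ½ + 1ℚ)
    {{D-positive (s≤s m≤j)}} {{D-positive m≤j}} (D-suc-suc j m)

κ[1+j]≡ω : ∀ {j m} u → m ≤ j →
           κ (suc j) m u ≡ ω j m u * ((ℕ→ℚ u + 1ℚ) * (ℕ→ℚ j + ½ - ℕ→ℚ m))
κ[1+j]≡ω {j} {m} u m≤j =
  *-transpose (κ j m u) ((ℕ→ℚ u + 1ℚ) * (ℕ→ℚ j + ½ - ℕ→ℚ m)) (δ j u) {{δ-positive j u}} (begin
  c * inv (D (suc j) m) * ((ℕ→ℚ u + 1ℚ) * (ℕ→ℚ j + ½ + 1ℚ))
    ≡⟨ swap c (inv (D (suc j) m)) (ℕ→ℚ u + 1ℚ) (ℕ→ℚ j + ½ + 1ℚ) ⟩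
  c * (ℕ→ℚ u + 1ℚ) * (inv (D (suc j) m) * (ℕ→ℚ j + ½ + 1ℚ))
    ≡⟨ cong (c * (ℕ→ℚ u + 1ℚ) *_) (inv-D-suc m≤j) ⟩
  c * (ℕ→ℚ u + 1ℚ) * (inv (D j m) * (ℕ→ℚ j + ½ - ℕ→ℚ m))
    ≡⟨ swap c (ℕ→ℚ u + 1ℚ) (inv (D j m)) (ℕ→ℚ j + ½ - ℕ→ℚ m) ⟩
  c * inv (D j m) * ((ℕ→ℚ u + 1ℚ) * (ℕ→ℚ j + ½ - ℕ→ℚ m))
    ∎)
  where
  open ≡-Reasoning
  c : ℚ
  c = ℕ→ℚ (m C u) * sgn u * ℕ→ℚ (m !)
  swap : ∀ c a b d → c * a * (b * d) ≡ c * b * (a * d)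
  swap = solve-∀ ℚ-ring

κ[1+j,1+m,1+u]≡ω : ∀ {j m u} → u ≤ m → m ≤ j →
  κ (suc j) (suc m) (suc u) ≡ ω j m u * - ((ℕ→ℚ m + 1ℚ) * (ℕ→ℚ m + 1ℚ))
κ[1+j,1+m,1+u]≡ω {j} {m} {u} u≤m m≤j =
  *-transpose (κ j m u) (- ((ℕ→ℚ m + 1ℚ) * (ℕ→ℚ m + 1ℚ))) (δ j u) {{δ-positive j u}} (begin
  ℕ→ℚ (suc m C suc u) * - sgn u * ℕ→ℚ (suc m !) * e′ * ((ℕ→ℚ u + 1ℚ) * (ℕ→ℚ j + ½ + 1ℚ))
    ≡⟨ shuffle (ℕ→ℚ (suc m C suc u)) (sgn u) (ℕ→ℚ (suc m !)) e′ (ℕ→ℚ u + 1ℚ) (ℕ→ℚ j + ½ + 1ℚ) ⟩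
  ℕ→ℚ (suc m C suc u) * (ℕ→ℚ u + 1ℚ) * - sgn u * ℕ→ℚ (suc m !) * (e′ * (ℕ→ℚ j + ½ + 1ℚ))
    ≡⟨ cong₂ (λ a b → a * - sgn u * ℕ→ℚ (suc m !) * b) binomial (inv-D-suc-suc m≤j) ⟩
  ℕ→ℚ (m C u) * (ℕ→ℚ m + 1ℚ) * - sgn u * ℕ→ℚ (suc m !) * (inv (D j m) * 1ℚ)
    ≡⟨ cong (λ a → ℕ→ℚ (m C u) * (ℕ→ℚ m + 1ℚ) * - sgn u * a * (inv (D j m) * 1ℚ)) factorial ⟩
  ℕ→ℚ (m C u) * (ℕ→ℚ m + 1ℚ) * - sgn u * ((ℕ→ℚ m + 1ℚ) * ℕ→ℚ (m !)) * (inv (D j m) * 1ℚ)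
    ≡⟨ shuffle′ (ℕ→ℚ (m C u)) (ℕ→ℚ m + 1ℚ) (sgn u) (ℕ→ℚ (m !)) (inv (D j m)) ⟩
  κ j m u * - ((ℕ→ℚ m + 1ℚ) * (ℕ→ℚ m + 1ℚ))
    ∎)
  where
  open ≡-Reasoning
  e′ : ℚ
  e′ = inv (D (suc j) (suc m))
  binomial : ℕ→ℚ (suc m C suc u) * (ℕ→ℚ u + 1ℚ) ≡ ℕ→ℚ (m C u) * (ℕ→ℚ m + 1ℚ)
  binomial = trans (sym (ℕ→ℚ-*-suc (suc m C suc u) u))
    (trans (cong ℕ→ℚ ([1+n]C[1+k]*[1+k]≡nCk*[1+n] u≤m)) (ℕ→ℚ-*-suc (m C u) m))
  factorial : ℕ→ℚ (suc m !) ≡ (ℕ→ℚ m + 1ℚ) * ℕ→ℚ (m !)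
  factorial = trans (ℕ→ℚ-* (suc m) (m !)) (cong (_* ℕ→ℚ (m !)) (ℕ→ℚ-suc m))
  shuffle : ∀ c s f e a r → c * - s * f * e * (a * r) ≡ c * a * - s * f * (e * r)
  shuffle = solve-∀ ℚ-ring
  shuffle′ : ∀ c a s f e → c * a * - s * (a * f) * (e * 1ℚ) ≡ c * s * f * e * - (a * a)
  shuffle′ = solve-∀ ℚ-ring

κ[1+j,m,1+u]≡ω : ∀ {j m u} → u ≤ m → m ≤ j →
  κ (suc j) m (suc u) ≡ ω j m u * - ((ℕ→ℚ m - ℕ→ℚ u) * (ℕ→ℚ j + ½ - ℕ→ℚ m))
κ[1+j,m,1+u]≡ω {j} {m} {u} u≤m m≤j =
  *-transpose (κ j m u) (- ((ℕ→ℚ m - ℕ→ℚ u) * (ℕ→ℚ j + ½ - ℕ→ℚ m))) (δ j u) {{δ-positive j u}} (begin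
  ℕ→ℚ (m C suc u) * - sgn u * ℕ→ℚ (m !) * e′ * ((ℕ→ℚ u + 1ℚ) * (ℕ→ℚ j + ½ + 1ℚ))
    ≡⟨ shuffle (ℕ→ℚ (m C suc u)) (sgn u) (ℕ→ℚ (m !)) e′ (ℕ→ℚ u + 1ℚ) (ℕ→ℚ j + ½ + 1ℚ) ⟩
  ℕ→ℚ (m C suc u) * (ℕ→ℚ u + 1ℚ) * - sgn u * ℕ→ℚ (m !) * (e′ * (ℕ→ℚ j + ½ + 1ℚ))
    ≡⟨ cong₂ (λ a b → a * - sgn u * ℕ→ℚ (m !) * b) binomial (inv-D-suc m≤j) ⟩
  ℕ→ℚ (m C u) * (ℕ→ℚ m - ℕ→ℚ u) * - sgn u * ℕ→ℚ (m !) * (inv (D j m) * (ℕ→ℚ j + ½ - ℕ→ℚ m))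
    ≡⟨ shuffle′ (ℕ→ℚ (m C u)) (ℕ→ℚ m - ℕ→ℚ u) (sgn u) (ℕ→ℚ (m !)) (inv (D j m)) (ℕ→ℚ j + ½ - ℕ→ℚ m) ⟩
  κ j m u * - ((ℕ→ℚ m - ℕ→ℚ u) * (ℕ→ℚ j + ½ - ℕ→ℚ m))
    ∎)
  where
  open ≡-Reasoning
  e′ : ℚ
  e′ = inv (D (suc j) m)
  binomial : ℕ→ℚ (m C suc u) * (ℕ→ℚ u + 1ℚ) ≡ ℕ→ℚ (m C u) * (ℕ→ℚ m - ℕ→ℚ u)
  binomial = trans (sym (ℕ→ℚ-*-suc (m C suc u) u))
    (trans (cong ℕ→ℚ (nC[1+k]*[1+k]≡nCk*[n∸k] u≤m))
    (trans (ℕ→ℚ-* (m C u) (m ∸ u)) (cong (ℕ→ℚ (m C u) *_) (ℕ→ℚ-∸ u≤m))))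
  shuffle : ∀ c s f e a r → c * - s * f * e * (a * r) ≡ c * a * - s * f * (e * r)
  shuffle = solve-∀ ℚ-ring
  shuffle′ : ∀ c a s f e p → c * a * - s * f * (e * p) ≡ c * s * f * e * - (a * p)
  shuffle′ = solve-∀ ℚ-ring

+[u+n]-+u≡+n : ∀ u n → + (u ℕ.+ n) ℤ.- + u ≡ + n
+[u+n]-+u≡+n u n = lemma (+ u) (+ n)
  where
  lemma : ∀ a b → a ℤ.+ b ℤ.- a ≡ b
  lemma = ℤ-Solver.solve-∀

-- F_{i,m,u} depends on i only through p = m + i, q = i + u and j = p + u.
F-factorised : ∀ x y (i : ℤ) {m u p q n j} →
  + m ℤ.+ i ≡ + p → i ℤ.+ + u ≡ + q → m ≡ u ℕ.+ n → p ℕ.+ u ≡ j →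
  F x y i m u ≡ κ j m u * central x j * (ff (y + ℕ→ℚ p) n * ff (y - ℕ→ℚ q - 1ℚ) n)
F-factorised x y i {u = u} {p} {q} {n} m+i≡p i+u≡q refl refl = begin
  c * Xf * Y⁺ * Y⁻               ≡⟨ ℚP.*-assoc (c * Xf) Y⁺ Y⁻ ⟩
  c * Xf * (Y⁺ * Y⁻)             ≡⟨ cong₂ _*_ (cong₂ _*_ coefficient centre)
                                              (cong₂ _*_ (cong₂ ffℤ (cong (λ z → y + ℤ→ℚ z) m+i≡p) (+[u+n]-+u≡+n u n))
                                                         (cong₂ ffℤ lower (+[u+n]-+u≡+n u n))) ⟩
  κ (p ℕ.+ u) (u ℕ.+ n) u * central x (p ℕ.+ u) * (ff (y + ℕ→ℚ p) n * ff (y - ℕ→ℚ q - 1ℚ) n)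
                                 ∎
  where
  open ≡-Reasoning
  m : ℕ
  m = u ℕ.+ n
  z : ℤ
  z = + m ℤ.+ i ℤ.+ + u
  c Xf Y⁺ Y⁻ : ℚ
  c = ℕ→ℚ (m C u) * sgn u * ℕ→ℚ (m !) * inv (ff (ℤ→ℚ z + ½) (suc m))
  Xf = ffℤ (x + ℤ→ℚ z) (+ 2 ℤ.* + m ℤ.+ + 2 ℤ.* i ℤ.+ + 2 ℤ.* + u ℤ.+ + 1)
  Y⁺ = ffℤ (y + ℤ→ℚ (+ m ℤ.+ i)) (+ m ℤ.- + u)
  Y⁻ = ffℤ (y - ℤ→ℚ i - ℕ→ℚ u - 1ℚ) (+ m ℤ.- + u)
  z≡ : z ≡ + (p ℕ.+ u)
  z≡ = cong (ℤ._+ + u) m+i≡p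
  coefficient : c ≡ κ (p ℕ.+ u) m u
  coefficient = cong (λ z → ℕ→ℚ (m C u) * sgn u * ℕ→ℚ (m !) * inv (ff (ℤ→ℚ z + ½) (suc m))) z≡
  double : ∀ a b c → + 2 ℤ.* a ℤ.+ + 2 ℤ.* b ℤ.+ + 2 ℤ.* c ℤ.+ + 1 ≡ + 2 ℤ.* (a ℤ.+ b ℤ.+ c) ℤ.+ + 1
  double = ℤ-Solver.solve-∀
  count : + 2 ℤ.* + m ℤ.+ + 2 ℤ.* i ℤ.+ + 2 ℤ.* + u ℤ.+ + 1 ≡ + suc (2 ℕ.* (p ℕ.+ u))
  count = trans (double (+ m) i (+ u))
    (trans (cong (λ t → + 2 ℤ.* t ℤ.+ + 1) z≡)
    (trans (cong (ℤ._+ + 1) (sym (ℤP.pos-* 2 (p ℕ.+ u))))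
           (cong +_ (ℕP.+-comm (2 ℕ.* (p ℕ.+ u)) 1))))
  centre : Xf ≡ central x (p ℕ.+ u)
  centre = cong₂ ffℤ (cong (λ z → x + ℤ→ℚ z) z≡) count
  regroup : ∀ y a b → y - a - b - 1ℚ ≡ y - (a + b) - 1ℚ
  regroup = solve-∀ ℚ-ring
  lower : y - ℤ→ℚ i - ℕ→ℚ u - 1ℚ ≡ y - ℕ→ℚ q - 1ℚ
  lower = trans (regroup y (ℤ→ℚ i) (ℕ→ℚ u))
    (cong (λ t → y - t - 1ℚ) (trans (sym (ℤ→ℚ-+ i (+ u))) (cong ℤ→ℚ i+u≡q)))

quadratic : ℚ → ℕ → ℕ → ℕ → ℚ
quadratic y i m l = y * y + ℕ→ℚ (l ℕ.* (2 ℕ.* m ℕ.+ 2 ℕ.* i ℕ.+ l ℕ.+ 2)) - ℕ→ℚ i * ℕ→ℚ i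

quadratic-cast : ∀ y i m l →
  quadratic y i m l ≡ y * y + ℕ→ℚ l * (ℕ→ℚ 2 * ℕ→ℚ m + ℕ→ℚ 2 * ℕ→ℚ i + ℕ→ℚ l + ℕ→ℚ 2) - ℕ→ℚ i * ℕ→ℚ i
quadratic-cast y i m l = cong (λ t → y * y + t - ℕ→ℚ i * ℕ→ℚ i)
  (trans (ℕ→ℚ-* l (2 ℕ.* m ℕ.+ 2 ℕ.* i ℕ.+ l ℕ.+ 2)) (cong (ℕ→ℚ l *_)
  (trans (ℕ→ℚ-+ (2 ℕ.* m ℕ.+ 2 ℕ.* i ℕ.+ l) 2) (cong (_+ ℕ→ℚ 2)
  (trans (ℕ→ℚ-+ (2 ℕ.* m ℕ.+ 2 ℕ.* i) l) (cong (_+ ℕ→ℚ l)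
  (trans (ℕ→ℚ-+ (2 ℕ.* m) (2 ℕ.* i)) (cong₂ _+_ (ℕ→ℚ-* 2 m) (ℕ→ℚ-* 2 i)))))))))

RHS-factorised : ∀ x y i {m l n j q} → m ≡ l ℕ.+ n → m ℕ.+ i ℕ.+ l ≡ j → i ℕ.+ l ≡ q →
  RHS x y i m l ≡
  κ j m l * quadratic y i m l * central x j * (ff (y + ℕ→ℚ (m ℕ.+ i)) n * ff (y - ℕ→ℚ q - 1ℚ) n)
RHS-factorised x y i {m} {l} {n} m≡l+n refl refl = begin
  c * Xf * Y⁺ * Y⁻               ≡⟨ ℚP.*-assoc (c * Xf) Y⁺ Y⁻ ⟩
  c * Xf * (Y⁺ * Y⁻)             ≡⟨ cong₂ _*_ (cong (λ k → c * ff (x + ℕ→ℚ (m ℕ.+ i ℕ.+ l)) k) (double m i l))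
                                              (cong₂ _*_ (cong (ffℤ _) index)
                                                         (cong₂ ffℤ lower index)) ⟩
  c * central x (m ℕ.+ i ℕ.+ l) * (ff (y + ℕ→ℚ (m ℕ.+ i)) n * ff (y - ℕ→ℚ (i ℕ.+ l) - 1ℚ) n)
                                 ∎
  where
  open ≡-Reasoning
  c Xf Y⁺ Y⁻ : ℚ
  c = κ (m ℕ.+ i ℕ.+ l) m l * quadratic y i m l
  Xf = ff (x + ℕ→ℚ (m ℕ.+ i ℕ.+ l)) (2 ℕ.* m ℕ.+ 2 ℕ.* i ℕ.+ 2 ℕ.* l ℕ.+ 1)
  Y⁺ = ffℤ (y + ℕ→ℚ (m ℕ.+ i)) (+ m ℤ.- + l)
  Y⁻ = ffℤ (y - ℕ→ℚ i - ℕ→ℚ l - 1ℚ) (+ m ℤ.- + l)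
  double : ∀ m i l → 2 ℕ.* m ℕ.+ 2 ℕ.* i ℕ.+ 2 ℕ.* l ℕ.+ 1 ≡ suc (2 ℕ.* (m ℕ.+ i ℕ.+ l))
  double = ℕ-Solver.solve-∀
  index : + m ℤ.- + l ≡ + n
  index = trans (cong (λ k → + k ℤ.- + l) m≡l+n) (+[u+n]-+u≡+n l n)
  regroup : ∀ y a b → y - a - b - 1ℚ ≡ y - (a + b) - 1ℚ
  regroup = solve-∀ ℚ-ring
  lower : y - ℕ→ℚ i - ℕ→ℚ l - 1ℚ ≡ y - ℕ→ℚ (i ℕ.+ l) - 1ℚ
  lower = trans (regroup y (ℕ→ℚ i) (ℕ→ℚ l)) (cong (λ t → y - t - 1ℚ) (sym (ℕ→ℚ-+ i l)))

-- T_l + R_{l+1} = R_l for m = l + 1 + e, with the scale w, the x-factor X = (x+N)_{2N+1}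
-- and the y-factor Z = (y+m+i)_e (y-i-l-2)_e shared by all five terms made explicit.
interior-recurrence : ∀ x y i l e m w X Y₀ Y₂ Z → m ≡ l + 1ℚ + e →
  Y₀ ≡ (y + (m + i) - e) * (y - (i + l) - 1ℚ) * Z →
  Y₂ ≡ (y + (m + i) + 1ℚ) * (y - (i + l) - 1ℚ - 1ℚ - e) * Z →
    - (ℕ→ℚ 2 * (w * ((l + 1ℚ) * (i + l + ½)) * ((x + (m + i + l) + 1ℚ) * X * (x - (m + i + l) - 1ℚ)) * Y₂))
    + (x * x + y * y - (i + m + 1ℚ) * (i + m + 1ℚ) - i * i) * (w * ((l + 1ℚ) * (m + i + l + ½ + 1ℚ)) * X * Y₀)
    - w * - ((ℕ→ℚ 2 * i - 1ℚ) * ((m + 1ℚ) * ½)) * ((x + (m + i + l) + 1ℚ) * X * (x - (m + i + l) - 1ℚ)) * Y₀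
    + w * - ((m - l) * (i + l + ½)) * (y * y + (l + 1ℚ) * (ℕ→ℚ 2 * m + ℕ→ℚ 2 * i + (l + 1ℚ) + ℕ→ℚ 2) - i * i)
        * ((x + (m + i + l) + 1ℚ) * X * (x - (m + i + l) - 1ℚ)) * Z
  ≡ w * ((l + 1ℚ) * (m + i + l + ½ + 1ℚ)) * (y * y + l * (ℕ→ℚ 2 * m + ℕ→ℚ 2 * i + l + ℕ→ℚ 2) - i * i) * X * Y₀
interior-recurrence x y i l e _ w X _ _ Z refl refl refl = solve (x ∷ y ∷ i ∷ l ∷ e ∷ w ∷ X ∷ Z ∷ []) ℚ-ring

-- The same for m = l, where the y-factors are empty and R_{l+1} = 0.
top-recurrence : ∀ x y i l m w X → m ≡ l →
    - (ℕ→ℚ 2 * (w * ((l + 1ℚ) * (i + l + ½)) * ((x + (m + i + l) + 1ℚ) * X * (x - (m + i + l) - 1ℚ)) * (1ℚ * 1ℚ)))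
    + (x * x + y * y - (i + m + 1ℚ) * (i + m + 1ℚ) - i * i) * (w * ((l + 1ℚ) * (m + i + l + ½ + 1ℚ)) * X * (1ℚ * 1ℚ))
    - w * - ((ℕ→ℚ 2 * i - 1ℚ) * ((m + 1ℚ) * ½)) * ((x + (m + i + l) + 1ℚ) * X * (x - (m + i + l) - 1ℚ)) * (1ℚ * 1ℚ)
    + 0ℚ
  ≡ w * ((l + 1ℚ) * (m + i + l + ½ + 1ℚ)) * (y * y + l * (ℕ→ℚ 2 * m + ℕ→ℚ 2 * i + l + ℕ→ℚ 2) - i * i) * X * (1ℚ * 1ℚ)
top-recurrence x y i l _ w X refl = solve (x ∷ y ∷ i ∷ l ∷ w ∷ X ∷ []) ℚ-ring

c-coeff : ℚ → ℚ → ℕ → ℕ → ℚ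
c-coeff x y i m = x * x + y * y - ℤ→ℚ (+ i ℤ.+ + m ℤ.+ + 1) * ℤ→ℚ (+ i ℤ.+ + m ℤ.+ + 1) - ℤ→ℚ (+ i) * ℤ→ℚ (+ i)

k-coeff : ℕ → ℕ → ℚ
k-coeff i m = ℤ→ℚ (+ 2 ℤ.* + i ℤ.- + 1) * inv (ℕ→ℚ (2 ℕ.* m ℕ.+ 2))

summand : ℚ → ℚ → ℕ → ℕ → ℕ → ℚ
summand x y i m u = lincomb (ℕ→ℚ 2) (c-coeff x y i m) (k-coeff i m)
  (F x y (+ i ℤ.+ + 1) m u) (F x y (+ i) m u) (F x y (+ i ℤ.- + 1) (suc m) (suc u))

M≡sumRange : ∀ x y i m l → M x y (+ i) m l ≡ sumRange l m (summand x y i m)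
M≡sumRange x y i m l = sym (sumBelow-lincomb (ℕ→ℚ 2) (c-coeff x y i m) (k-coeff i m) (suc m ∸ l) _ _ _)

module NormalForms (x y : ℚ) (i m l : ℕ) where

  N : ℕ
  N = m ℕ.+ i ℕ.+ l

  iℚ lℚ mℚ Nℚ ω₀ X₀ X₁ a b : ℚ
  iℚ = ℕ→ℚ i
  lℚ = ℕ→ℚ l
  mℚ = ℕ→ℚ m
  Nℚ = mℚ + iℚ + lℚ
  ω₀ = ω N m l
  X₀ = central x N
  X₁ = (x + Nℚ + 1ℚ) * X₀ * (x - Nℚ - 1ℚ)
  a = y + (mℚ + iℚ)
  b = y - (iℚ + lℚ) - 1ℚ

  Q : ℚ → ℚ
  Q t = y * y + t * (ℕ→ℚ 2 * mℚ + ℕ→ℚ 2 * iℚ + t + ℕ→ℚ 2) - iℚ * iℚ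

  m≤N : m ≤ N
  m≤N = ℕP.≤-trans (ℕP.m≤m+n m i) (ℕP.m≤m+n (m ℕ.+ i) l)

  N-cast : ℕ→ℚ N ≡ Nℚ
  N-cast = trans (ℕ→ℚ-+ (m ℕ.+ i) l) (cong (_+ lℚ) (ℕ→ℚ-+ m i))

  N-m-cast : ℕ→ℚ N + ½ - mℚ ≡ iℚ + lℚ + ½
  N-m-cast = trans (cong (λ t → t + ½ - mℚ) N-cast) (cancel mℚ iℚ lℚ)
    where
    cancel : ∀ m i l → m + i + l + ½ - m ≡ i + l + ½
    cancel = solve-∀ ℚ-ring

  central-cast : central x (suc N) ≡ X₁
  central-cast = trans (central-suc x N) (cong (λ t → (x + t + 1ℚ) * X₀ * (x - t - 1ℚ)) N-cast)

  a-cast : y + ℕ→ℚ (m ℕ.+ i) ≡ a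
  a-cast = cong (λ t → y + t) (ℕ→ℚ-+ m i)

  b-cast : y - ℕ→ℚ (i ℕ.+ l) - 1ℚ ≡ b
  b-cast = cong (λ t → y - t - 1ℚ) (ℕ→ℚ-+ i l)

  a+1-cast : y + ℕ→ℚ (suc (m ℕ.+ i)) ≡ a + 1ℚ
  a+1-cast = trans (cong (λ t → y + t) (ℕ→ℚ-suc (m ℕ.+ i)))
                   (trans (sym (ℚP.+-assoc y _ 1ℚ)) (cong (λ t → t + 1ℚ) a-cast))

  b-1-cast : y - ℕ→ℚ (suc (i ℕ.+ l)) - 1ℚ ≡ b - 1ℚ
  b-1-cast = trans (cong (λ t → y - t - 1ℚ) (ℕ→ℚ-suc (i ℕ.+ l)))
                   (trans (shift y (ℕ→ℚ (i ℕ.+ l))) (cong (_- 1ℚ) b-cast))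
    where
    shift : ∀ y t → y - (t + 1ℚ) - 1ℚ ≡ y - t - 1ℚ - 1ℚ
    shift = solve-∀ ℚ-ring

  c-cast : c-coeff x y i m ≡ x * x + y * y - (iℚ + mℚ + 1ℚ) * (iℚ + mℚ + 1ℚ) - iℚ * iℚ
  c-cast = cong (λ t → x * x + y * y - t * t - iℚ * iℚ)
                (trans (ℕ→ℚ-+ (i ℕ.+ m) 1) (cong (_+ 1ℚ) (ℕ→ℚ-+ i m)))

  κ-nf : κ N m l ≡ ω₀ * ((lℚ + 1ℚ) * (Nℚ + ½ + 1ℚ))
  κ-nf = trans (κ≡ω*δ N m l) (cong (λ t → ω₀ * ((lℚ + 1ℚ) * (t + ½ + 1ℚ))) N-cast)

  module _ {n} (m≡l+n : m ≡ l ℕ.+ n) where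

    l≤m : l ≤ m
    l≤m = subst (l ≤_) (sym m≡l+n) (ℕP.m≤m+n l n)

    F[i]-nf : F x y (+ i) m l ≡ ω₀ * ((lℚ + 1ℚ) * (Nℚ + ½ + 1ℚ)) * X₀ * (ff a n * ff b n)
    F[i]-nf = trans (F-factorised x y (+ i) {m} {l} {m ℕ.+ i} {i ℕ.+ l} {n} {N} refl refl m≡l+n refl)
                  (cong₂ _*_ (cong (_* X₀) κ-nf) (ff-pair-cong n a-cast b-cast))

    F[i+1]-nf : F x y (+ i ℤ.+ + 1) m l ≡
            ω₀ * ((lℚ + 1ℚ) * (iℚ + lℚ + ½)) * X₁ * (ff (a + 1ℚ) n * ff (b - 1ℚ) n)
    F[i+1]-nf = trans (F-factorised x y (+ i ℤ.+ + 1) {m} {l} {suc (m ℕ.+ i)} {suc (i ℕ.+ l)} {n} {suc N}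
                                (cong +_ (trans (cong (m ℕ.+_) (ℕP.+-comm i 1)) (ℕP.+-suc m i)))
                                (cong (λ k → + (k ℕ.+ l)) (ℕP.+-comm i 1)) m≡l+n refl)
                  (cong₂ _*_ (cong₂ _*_ κ₁-nf central-cast) (ff-pair-cong n a+1-cast b-1-cast))
      where
      κ₁-nf : κ (suc N) m l ≡ ω₀ * ((lℚ + 1ℚ) * (iℚ + lℚ + ½))
      κ₁-nf = trans (κ[1+j]≡ω l m≤N) (cong (λ t → ω₀ * ((lℚ + 1ℚ) * t)) N-m-cast)

    K*F[i-1]-nf : k-coeff i m * F x y (+ i ℤ.- + 1) (suc m) (suc l) ≡
             ω₀ * - ((ℕ→ℚ 2 * iℚ - 1ℚ) * ((mℚ + 1ℚ) * ½)) * X₁ * (ff a n * ff b n)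
    K*F[i-1]-nf = begin
      k-coeff i m * F x y (+ i ℤ.- + 1) (suc m) (suc l)
        ≡⟨ cong (k-coeff i m *_) (F-factorised x y (+ i ℤ.- + 1) {suc m} {suc l} {m ℕ.+ i} {i ℕ.+ l} {n} {suc N}
                                   (shift₁ (+ m) (+ i)) (shift₂ (+ i) (+ l)) (cong suc m≡l+n) (ℕP.+-suc (m ℕ.+ i) l)) ⟩
      k-coeff i m * (κ (suc N) (suc m) (suc l) * central x (suc N) * (ff (y + ℕ→ℚ (m ℕ.+ i)) n * ff (y - ℕ→ℚ (i ℕ.+ l) - 1ℚ) n))
        ≡⟨ cong (k-coeff i m *_) (cong₂ _*_ (cong₂ _*_ (κ[1+j,1+m,1+u]≡ω l≤m m≤N) central-cast) (ff-pair-cong n a-cast b-cast)) ⟩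
      k * h * (ω₀ * - ((mℚ + 1ℚ) * (mℚ + 1ℚ)) * X₁ * (ff a n * ff b n))
        ≡⟨ shuffle k h ω₀ ((mℚ + 1ℚ) * (mℚ + 1ℚ)) X₁ (ff a n * ff b n) ⟩
      ω₀ * - (k * (h * ((mℚ + 1ℚ) * (mℚ + 1ℚ)))) * X₁ * (ff a n * ff b n)
        ≡⟨ cong₂ (λ s t → ω₀ * - (s * t) * X₁ * (ff a n * ff b n)) k-cast (inv[2n+2]*[n+1]²≡[n+1]*½ m) ⟩
      ω₀ * - ((ℕ→ℚ 2 * iℚ - 1ℚ) * ((mℚ + 1ℚ) * ½)) * X₁ * (ff a n * ff b n)
        ∎
      where
      open ≡-Reasoning
      k h : ℚ
      k = ℤ→ℚ (+ 2 ℤ.* + i ℤ.- + 1)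
      h = inv (ℕ→ℚ (2 ℕ.* m ℕ.+ 2))
      shift₁ : ∀ a b → (+ 1 ℤ.+ a) ℤ.+ (b ℤ.- + 1) ≡ a ℤ.+ b
      shift₁ = ℤ-Solver.solve-∀
      shift₂ : ∀ a b → (a ℤ.- + 1) ℤ.+ (+ 1 ℤ.+ b) ≡ a ℤ.+ b
      shift₂ = ℤ-Solver.solve-∀
      k-cast : k ≡ ℕ→ℚ 2 * iℚ - 1ℚ
      k-cast = trans (ℤ→ℚ-+ (+ 2 ℤ.* + i) -[1+ 0 ]) (cong (_- 1ℚ) (ℤ→ℚ-* (+ 2) (+ i)))
      shuffle : ∀ k h w s X Y → k * h * (w * - s * X * Y) ≡ w * - (k * (h * s)) * X * Y
      shuffle = solve-∀ ℚ-ring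

    RHS[l]-nf : RHS x y i m l ≡ ω₀ * ((lℚ + 1ℚ) * (Nℚ + ½ + 1ℚ)) * Q lℚ * X₀ * (ff a n * ff b n)
    RHS[l]-nf = trans (RHS-factorised x y i {m} {l} {n} {N} {i ℕ.+ l} m≡l+n refl refl)
                  (cong₂ _*_ (cong (_* X₀) (cong₂ _*_ κ-nf (quadratic-cast y i m l))) (ff-pair-cong n a-cast b-cast))

  RHS[l+1]-nf : ∀ {e} → m ≡ l ℕ.+ suc e →
          RHS x y i m (suc l) ≡ ω₀ * - ((mℚ - lℚ) * (iℚ + lℚ + ½)) * Q (lℚ + 1ℚ) * X₁ * (ff a e * ff (b - 1ℚ) e)
  RHS[l+1]-nf {e} m≡l+1+e =
    trans (RHS-factorised x y i {m} {suc l} {e} {suc N} {suc (i ℕ.+ l)}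
                          (trans m≡l+1+e (ℕP.+-suc l e)) (ℕP.+-suc (m ℕ.+ i) l) (ℕP.+-suc i l))
          (cong₂ _*_ (cong₂ _*_ (cong₂ _*_ κ₅-nf quadratic-suc-cast) central-cast) (ff-pair-cong e a-cast b-1-cast))
    where
    κ₅-nf : κ (suc N) m (suc l) ≡ ω₀ * - ((mℚ - lℚ) * (iℚ + lℚ + ½))
    κ₅-nf = trans (κ[1+j,m,1+u]≡ω (l≤m m≡l+1+e) m≤N) (cong (λ t → ω₀ * - ((mℚ - lℚ) * t)) N-m-cast)
    quadratic-suc-cast : quadratic y i m (suc l) ≡ Q (lℚ + 1ℚ)
    quadratic-suc-cast = trans (quadratic-cast y i m (suc l)) (cong Q (ℕ→ℚ-suc l))

RHS-vanishes : ∀ x y i m → RHS x y i m (suc m) ≡ 0ℚ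
RHS-vanishes x y i m =
  ≡0⇒*≡0 (≡0⇒*≡0 (≡0⇒*≡0 (≡0⇒*≡0 (≡0⇒*≡0 (≡0⇒*≡0 (≡0⇒*≡0 (cong ℕ→ℚ (k>n⇒nCk≡0 (ℕP.n<1+n m)))))))))
  where
  ≡0⇒*≡0 : ∀ {a b} → a ≡ 0ℚ → a * b ≡ 0ℚ
  ≡0⇒*≡0 {b = b} a≡0 = trans (cong (_* b) a≡0) (ℚP.*-zeroˡ b)

summand-step-interior : ∀ x y i l e →
  summand x y i (l ℕ.+ suc e) l + RHS x y i (l ℕ.+ suc e) (suc l) ≡ RHS x y i (l ℕ.+ suc e) l
summand-step-interior x y i l e =
  trans (cong₂ _+_ (cong₂ _-_ (cong₂ _+_ (cong (λ t → - (ℕ→ℚ 2 * t)) (F[i+1]-nf refl))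
                                         (cong₂ _*_ c-cast (F[i]-nf refl)))
                              (K*F[i-1]-nf refl))
                   (RHS[l+1]-nf refl))
  (trans (interior-recurrence x y iℚ lℚ (ℕ→ℚ e) mℚ ω₀ X₀ _ _ _ m-cast (ff-pair-peel a b e) (ff-pair-shift-peel a b e))
         (sym (RHS[l]-nf refl)))
  where
  open NormalForms x y i (l ℕ.+ suc e) l
  m-cast : mℚ ≡ lℚ + 1ℚ + ℕ→ℚ e
  m-cast = trans (ℕ→ℚ-+ l (suc e)) (trans (cong (λ t → lℚ + t) (ℕ→ℚ-+ 1 e)) (sym (ℚP.+-assoc lℚ 1ℚ (ℕ→ℚ e))))

summand-step-top : ∀ x y i l → summand x y i l l + RHS x y i l (suc l) ≡ RHS x y i l l
summand-step-top x y i l =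
  trans (cong₂ _+_ (cong₂ _-_ (cong₂ _+_ (cong (λ t → - (ℕ→ℚ 2 * t)) (F[i+1]-nf l≡l+0))
                                         (cong₂ _*_ c-cast (F[i]-nf l≡l+0)))
                              (K*F[i-1]-nf l≡l+0))
                   (RHS-vanishes x y i l))
  (trans (top-recurrence x y iℚ lℚ mℚ ω₀ X₀ refl) (sym (RHS[l]-nf l≡l+0)))
  where
  open NormalForms x y i l l
  l≡l+0 : l ≡ l ℕ.+ 0
  l≡l+0 = sym (ℕP.+-identityʳ l)

summand-step : ∀ x y i m u → u ≤ m → summand x y i m u + RHS x y i m (suc u) ≡ RHS x y i m u
summand-step x y i m u u≤m = subst Step (ℕP.m+[n∸m]≡n u≤m) (by-gap (m ∸ u))
  where
  Step : ℕ → Set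
  Step k = summand x y i k u + RHS x y i k (suc u) ≡ RHS x y i k u
  by-gap : ∀ n → Step (u ℕ.+ n)
  by-gap zero    = subst Step (sym (ℕP.+-identityʳ u)) (summand-step-top x y i u)
  by-gap (suc e) = summand-step-interior x y i u e

lemma1 : (i m l : ℕ) → l ≤ suc m → (x y : ℚ) →
    M x y (+ i) m l ≡ RHS x y i m l
lemma1 i m l l≤1+m x y = begin
  M x y (+ i) m l                                        ≡⟨ M≡sumRange x y i m l ⟩
  sumRange l m (summand x y i m)                         ≡⟨ ℚP.+-identityʳ _ ⟨
  sumRange l m (summand x y i m) + 0ℚ                    ≡⟨ cong (λ t → sumRange l m (summand x y i m) + t) (RHS-vanishes x y i m) ⟨
  sumRange l m (summand x y i m) + RHS x y i m (suc m)   ≡⟨ sumRange-telescope l m (summand x y i m) (RHS x y i m) l≤1+m (λ u _ → summand-step x y i m u) ⟩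
  RHS x y i m l                                          ∎
  where open ≡-Reasoning
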